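{- Let $G$ be a permutation group on a finite set $\Omega$ with Property $(\star)$. Then $\mathcal{LS}(G)$ is a linear space and $G\leq \mathrm{Aut}(\mathcal{LS}(G))$.
   Context: A permutation group $G$ on $\Omega$ has Property $(\star)$ if for all $u,v,w\in\Omega$ with $u\neq w$, $G_{uv}\leq G_w$ implies $G_{uw}\leq G_v$ (here $G_{uv}$ is the pointwise stabiliser of $u,v$). For $u,v\in\Omega$ let $\Lambda_{uv}=\{w\in\Omega: G_{uv}\leq G_w\}$, and let $\mathcal{LS}(G)$ be the incidence structure with point set $\Omega$ and line set $\{\Lambda_{uv}: u,v\in\Omega,\ u\neq v\}$. A linear space is a pair (points, lines) where lines are subsets of the point set and every two distinct points lie in exactly one line; its automorphism group consists of permutations of the points preserving the set of lines. -}

module Defs where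

open import Data.Nat.Base using (ℕ)
open import Data.Fin.Base using (Fin)
open import Data.Fin.Permutation using (Permutation′; _⟨$⟩ʳ_; _⟨$⟩ˡ_; id; flip; _∘ₚ_)
open import Data.Product.Base using (Σ; ∃; ∃-syntax; _×_; _,_)
open import Relation.Binary.PropositionalEquality using (_≡_)
open import Relation.Nullary using (¬_)
open import Function.Bundles using (_⇔_)
open import Level using (suc; zero)

record PermGroup (n : ℕ) : Set₁ where
  field
    _∈G : Permutation′ n → Set
    id∈ : id ∈G
    ∘∈  : ∀ {g h} → g ∈G → h ∈G → (g ∘ₚ h) ∈G
    inv∈ : ∀ {g} → g ∈G → flip g ∈G
open PermGroup public

module _ {n : ℕ} (G : PermGroup n) where

  StabLe : Fin n → Fin n → Fin n → Set
  StabLe u v w = ∀ g → _∈G G g → g ⟨$⟩ʳ u ≡ u → g ⟨$⟩ʳ v ≡ v → g ⟨$⟩ʳ w ≡ w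

  PropertyStar : Set
  PropertyStar = ∀ u v w → ¬ (u ≡ w) → StabLe u v w → StabLe u w v

  Λ : Fin n → Fin n → Fin n → Set
  Λ u v = StabLe u v

Subset : ℕ → Set₁
Subset n = Fin n → Set

_≐_ : ∀ {n} → Subset n → Subset n → Set
A ≐ B = ∀ x → A x ⇔ B x

-- An incidence structure on point set Fin n: a family of lines (a predicate on subsets,
-- here the LS(G) line predicate is by construction invariant under ≐).
LineSet : ℕ → Set₁
LineSet n = Subset n → Set

LSLine : ∀ {n} → PermGroup n → LineSet n
LSLine G L = ∃[ u ] ∃[ v ] (¬ (u ≡ v) × (L ≐ Λ G u v))

IsLinearSpace : ∀ {n} → LineSet n → Set₁
IsLinearSpace {n} Line =
  ∀ x y → ¬ (x ≡ y) →
    ∃[ L ] (Line L × L x × L y ×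
      (∀ L′ → Line L′ → L′ x → L′ y → L′ ≐ L))

image : ∀ {n} → Permutation′ n → Subset n → Subset n
image σ L x = L (σ ⟨$⟩ˡ x)

IsAutomorphism : ∀ {n} → LineSet n → Permutation′ n → Set₁
IsAutomorphism Line σ = ∀ L → (Line L → Line (image σ L)) × (Line (image σ L) → Line L)

SubgroupOfAut : ∀ {n} → PermGroup n → LineSet n → Set₁
SubgroupOfAut G Line = ∀ g → _∈G G g → IsAutomorphism Line g

{-# OPTIONS --safe #-}
-- Under (⋆), a point w ≠ u on Λ_{uv} has G_{uw} = G_{uv}, so Λ_{uw} = Λ_{uv}: any point of a
-- line other than u may replace v. Replacing twice shows that every line through two distinct
-- points x, y equals Λ_{xy}. The group acts on lines since g Λ_{uv} = Λ_{gu,gv} by conjugating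
-- stabilisers.
module Submission where

open import Defs
open import Data.Nat.Base using (ℕ)
open import Data.Product.Base using (_×_; _,_)
open import Data.Fin.Base using (Fin)
open import Data.Fin.Properties using (_≟_)
open import Data.Fin.Permutation using (Permutation′; _⟨$⟩ʳ_; _⟨$⟩ˡ_; flip; _∘ₚ_; inverseˡ; inverseʳ)
open import Relation.Binary.PropositionalEquality using (_≡_; refl; sym; trans; cong; subst; subst₂)
open import Relation.Nullary using (¬_; yes; no)
open import Function.Bundles using (_⇔_; mk⇔; Equivalence)
open import Function.Construct.Identity using (⇔-id)
open import Function.Construct.Symmetry using (⇔-sym)
open import Function.Construct.Composition using (_⇔-∘_)

module _ {n : ℕ} where

  ≐-refl : {A : Subset n} → A ≐ A
  ≐-refl {A} x = ⇔-id (A x)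

  ≐-sym : {A B : Subset n} → A ≐ B → B ≐ A
  ≐-sym A≐B x = ⇔-sym (A≐B x)

  ≐-trans : {A B C : Subset n} → A ≐ B → B ≐ C → A ≐ C
  ≐-trans A≐B B≐C x = B≐C x ⇔-∘ A≐B x

  permutation-injective : (g : Permutation′ n) {a b : Fin n} → g ⟨$⟩ʳ a ≡ g ⟨$⟩ʳ b → a ≡ b
  permutation-injective g ga≡gb =
    trans (sym (inverseˡ g)) (trans (cong (g ⟨$⟩ˡ_) ga≡gb) (inverseˡ g))

  image-flip-image : (g : Permutation′ n) (L : Subset n) → image (flip g) (image g L) ≐ L
  image-flip-image g L x = subst (λ y → L y ⇔ L x) (sym (inverseˡ g)) (⇔-id (L x))

module _ {n : ℕ} (G : PermGroup n) where

  Λ-∋ˡ : ∀ u v → Λ G u v u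
  Λ-∋ˡ u v g _ gu≡u _ = gu≡u

  Λ-∋ʳ : ∀ u v → Λ G u v v
  Λ-∋ʳ u v g _ _ gv≡v = gv≡v

  Λ-comm : ∀ u v → Λ G u v ≐ Λ G v u
  Λ-comm u v z = mk⇔ (λ s g g∈ gv gu → s g g∈ gu gv) (λ s g g∈ gu gv → s g g∈ gv gu)

  LSLine-resp-≐ : {L M : Subset n} → L ≐ M → LSLine G L → LSLine G M
  LSLine-resp-≐ L≐M (u , v , u≢v , L≐Λuv) = u , v , u≢v , ≐-trans (≐-sym L≐M) L≐Λuv

  StabLe-conj : ∀ g → _∈G G g → ∀ {a b c} → StabLe G a b c →
                StabLe G (g ⟨$⟩ʳ a) (g ⟨$⟩ʳ b) (g ⟨$⟩ʳ c)
  StabLe-conj g g∈ s h h∈ hga≡ga hgb≡gb =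
    trans (sym (inverseʳ g)) (cong (g ⟨$⟩ʳ_) (s (g ∘ₚ (h ∘ₚ flip g)) k∈ (fixed hga≡ga) (fixed hgb≡gb)))
    where
      k∈ : _∈G G (g ∘ₚ (h ∘ₚ flip g))
      k∈ = ∘∈ G g∈ (∘∈ G h∈ (inv∈ G g∈))

      fixed : ∀ {x} → h ⟨$⟩ʳ (g ⟨$⟩ʳ x) ≡ g ⟨$⟩ʳ x → g ⟨$⟩ˡ (h ⟨$⟩ʳ (g ⟨$⟩ʳ x)) ≡ x
      fixed hgx≡gx = trans (cong (g ⟨$⟩ˡ_) hgx≡gx) (inverseˡ g)

  image-Λ : ∀ g → _∈G G g → ∀ u v → image g (Λ G u v) ≐ Λ G (g ⟨$⟩ʳ u) (g ⟨$⟩ʳ v)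
  image-Λ g g∈ u v x = mk⇔
    (λ s → subst (StabLe G (g ⟨$⟩ʳ u) (g ⟨$⟩ʳ v)) (inverseʳ g) (StabLe-conj g g∈ s))
    (λ s → subst₂ (λ a b → StabLe G a b (g ⟨$⟩ˡ x)) (inverseˡ g) (inverseˡ g)
                  (StabLe-conj (flip g) (inv∈ G g∈) s))

  image-LSLine : ∀ g → _∈G G g → ∀ {L} → LSLine G L → LSLine G (image g L)
  image-LSLine g g∈ (u , v , u≢v , L≐Λuv) =
    g ⟨$⟩ʳ u , g ⟨$⟩ʳ v , (λ gu≡gv → u≢v (permutation-injective g gu≡gv)) ,
    ≐-trans (λ x → L≐Λuv (g ⟨$⟩ˡ x)) (image-Λ g g∈ u v)

  G≤Aut-LS : SubgroupOfAut G (LSLine G)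
  G≤Aut-LS g g∈ L =
    image-LSLine g g∈ ,
    λ gL → LSLine-resp-≐ (image-flip-image g L) (image-LSLine (flip g) (inv∈ G g∈) gL)

  module _ (star : PropertyStar G) where

    Λ-replaceʳ : ∀ {u v w} → ¬ (u ≡ w) → Λ G u v w → Λ G u v ≐ Λ G u w
    Λ-replaceʳ {u} {v} {w} u≢w w∈Λuv z = mk⇔
      (λ s g g∈ gu gw → s g g∈ gu (star u v w u≢w w∈Λuv g g∈ gu gw))
      (λ s g g∈ gu gv → s g g∈ gu (w∈Λuv g g∈ gu gv))

    Λ-unique : ∀ {u v x y} → ¬ (x ≡ y) → Λ G u v x → Λ G u v y → Λ G u v ≐ Λ G x y
    Λ-unique {u} {v} {x} {y} x≢y x∈ y∈ with u ≟ x
    ... | yes refl = Λ-replaceʳ x≢y y∈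
    ... | no u≢x = ≐-trans Λuv≐Λxu (Λ-replaceʳ x≢y (Equivalence.to (Λuv≐Λxu y) y∈))
      where
        Λuv≐Λxu : Λ G u v ≐ Λ G x u
        Λuv≐Λxu = ≐-trans (Λ-replaceʳ u≢x x∈) (Λ-comm u x)

    LS-isLinearSpace : IsLinearSpace (LSLine G)
    LS-isLinearSpace x y x≢y =
      Λ G x y , (x , y , x≢y , ≐-refl) , Λ-∋ˡ x y , Λ-∋ʳ x y ,
      λ { L (u , v , _ , L≐Λuv) x∈L y∈L →
            ≐-trans L≐Λuv (Λ-unique x≢y (Equivalence.to (L≐Λuv x) x∈L)
                                        (Equivalence.to (L≐Λuv y) y∈L)) }

proposition3p2 : (n : ℕ) (G : PermGroup n) → PropertyStar G →
    IsLinearSpace (LSLine G) × SubgroupOfAut G (LSLine G)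
proposition3p2 n G star = LS-isLinearSpace G star , G≤Aut-LS G
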